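{- Every flow-admissible signed circular ladder $CL_4$ has a nowhere-zero $6$-flow.
   Context: The circular ladder $CL_4$ has vertices $v_1,\dots,v_4,u_1,\dots,u_4$ and edges $v_jv_{j+1}$, $u_ju_{j+1}$ (indices modulo $4$) and rungs $v_ju_j$; a signed circular ladder carries a sign $+$ or $-$ on each edge. An orientation of a signed graph splits each edge into two half-edges; a positive edge has one half-edge directed away from and one towards its end-vertex, a negative edge has both half-edges directed towards, or both away from, their end-vertices. A nowhere-zero $k$-flow is an orientation with values from $\{\pm1,\dots,\pm(k-1)\}$ on the edges such that at every vertex the sum of incoming values equals the sum of outgoing values. A signed graph is flow-admissible if it admits a nowhere-zero $k$-flow for some $k$. -}

module Defs where

open import Data.Nat using (ℕ)
open import Data.Fin using (Fin; zero; suc; _≟_)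
open import Data.Fin.Patterns
open import Data.List using (List; allFin; foldr; map; concatMap)
open import Data.Integer using (ℤ; +_; -_; _+_; _*_; ∣_∣)
import Data.Nat as N
open import Data.Product using (Σ; _×_; _,_; ∃)
open import Relation.Nullary using (yes; no)
open import Relation.Binary.PropositionalEquality using (_≡_)

data Sign : Set where
  pos neg : Sign

⟦_⟧ : Sign → ℤ
⟦ pos ⟧ = + 1
⟦ neg ⟧ = - (+ 1)

-- Circular ladder CL₄.
-- Vertices: Fin 8, with v_j = j (j = 0..3) and u_j = 4 + j.
Vertex : Set
Vertex = Fin 8

-- Edges: Fin 12.  Edge j (j=0..3) is v_j v_{j+1}, edge 4+j is u_j u_{j+1},
-- edge 8+j is the rung v_j u_j (indices mod 4).
Edge : Set
Edge = Fin 12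

-- A half-edge is an edge together with one of its two ends (Fin 2).
-- endpoint e s is the vertex at end s of edge e.
endpoint : Edge → Fin 2 → Vertex
endpoint 0F  0F = 0F
endpoint 0F  1F = 1F
endpoint 1F  0F = 1F
endpoint 1F  1F = 2F
endpoint 2F  0F = 2F
endpoint 2F  1F = 3F
endpoint 3F  0F = 3F
endpoint 3F  1F = 0F
endpoint 4F  0F = 4F
endpoint 4F  1F = 5F
endpoint 5F  0F = 5F
endpoint 5F  1F = 6F
endpoint 6F  0F = 6F
endpoint 6F  1F = 7F
endpoint 7F  0F = 7F
endpoint 7F  1F = 4F
endpoint 8F  0F = 0F
endpoint 8F  1F = 4F
endpoint 9F  0F = 1F
endpoint 9F  1F = 5F
endpoint (suc 9F) 0F = 2F
endpoint (suc 9F) 1F = 6F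
endpoint (suc (suc 9F)) 0F = 3F
endpoint (suc (suc 9F)) 1F = 7F

Signature : Set
Signature = Edge → Sign

-- An orientation assigns to each half-edge a direction:
-- pos = directed away from its end-vertex (outgoing),
-- neg = directed towards its end-vertex (incoming).
-- Compatibility with the signature: a positive edge has one half-edge
-- away and one towards (product -1); a negative edge has both half-edges
-- the same way (product +1).
Orientation : Set
Orientation = Edge → Fin 2 → Sign

IsOrientation : Signature → Orientation → Set
IsOrientation σ τ = ∀ (e : Edge) → ⟦ τ e 0F ⟧ * ⟦ τ e 1F ⟧ ≡ - ⟦ σ e ⟧

contrib : Orientation → (Edge → ℤ) → Vertex → Edge → Fin 2 → ℤ
contrib τ f v e s with endpoint e s ≟ v
... | yes _ = ⟦ τ e s ⟧ * f e
... | no  _ = + 0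

boundary : Orientation → (Edge → ℤ) → Vertex → ℤ
boundary τ f v =
  foldr _+_ (+ 0)
    (concatMap (λ e → map (contrib τ f v e) (allFin 2)) (allFin 12))

NowhereZeroFlow : Signature → ℕ → Set
NowhereZeroFlow σ k =
  Σ Orientation λ τ → Σ (Edge → ℤ) λ f →
    IsOrientation σ τ
    × (∀ e → 1 N.≤ ∣ f e ∣ × ∣ f e ∣ N.< k)
    × (∀ v → boundary τ f v ≡ + 0)

FlowAdmissible : Signature → Set
FlowAdmissible σ = ∃ λ k → NowhereZeroFlow σ k

module Submission where

-- Switching a signature at a vertex (reversing the half-edges there) carries nowhere-zero
-- k-flows to nowhere-zero k-flows.  Switching along the spanning tree formed by the path
-- v₁v₂v₃v₄ and the four rungs makes every tree edge positive, so only the signs of the five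
-- cotree edges v₄v₁, u₁u₂, u₂u₃, u₃u₄, u₄u₁ remain: 32 cases.  Twelve of them are switchings
-- of a signature with a single negative edge, which has no nowhere-zero flow at all: adding
-- the conservation laws of all vertices, the two half-edges of each positive edge cancel and
-- only twice the value on the negative edge remains.  Each of the other twenty carries an
-- explicit nowhere-zero 6-flow.

open import Defs
open import Algebra.Bundles using (Semiring)
open import Data.Bool using (if_then_else_)
open import Data.Empty using (⊥-elim)
open import Data.Fin using (Fin; zero; suc; _≟_)
open import Data.Fin.Patterns
open import Data.Fin.Properties using (suc-injective; all?)
open import Data.List using (List; []; _∷_; _++_; foldr; map; concatMap; allFin)
open import Data.List.Properties using (map-tabulate)
open import Data.Nat using (suc)
import Data.Nat as ℕ
open import Data.Product using (_×_; _,_; ∃-syntax; proj₁)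
open import Data.Sum using (_⊎_; inj₁; inj₂)
open import Data.Vec using (Vec; []; _∷_; lookup)
open import Function using (_∘_; id)
open import Level using (Level)
open import Relation.Binary.Definitions using (DecidableEquality)
open import Relation.Binary.PropositionalEquality as ≡ using (_≡_; _≢_; _≗_)
open import Relation.Nullary using (¬_; Dec; yes; no; does; contradiction)
open import Relation.Nullary.Decidable using (True; toWitness; _×-dec_; dec-true; dec-false)

pattern 10F = suc 9F
pattern 11F = suc 10F

module ListSum {c ℓ} (R : Semiring c ℓ) where

  open Semiring R hiding (zero)
  open import Algebra.Properties.CommutativeSemigroup +-commutativeSemigroup using (interchange)
  open import Relation.Binary.Reasoning.Setoid setoid

  private variable
    a b : Level
    A : Set a
    B : Set b

  sum : List Carrier → Carrier
  sum = foldr _+_ 0#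

  ∑ : List A → (A → Carrier) → Carrier
  ∑ xs g = sum (map g xs)

  infix 5 ∑
  syntax ∑ xs (λ x → g) = ∑[ x ∈ xs ] g

  sum-++ : ∀ xs ys → sum (xs ++ ys) ≈ sum xs + sum ys
  sum-++ []       ys = sym (+-identityˡ (sum ys))
  sum-++ (x ∷ xs) ys = trans (+-congˡ (sum-++ xs ys)) (sym (+-assoc x (sum xs) (sum ys)))

  sum-concatMap : ∀ (h : A → List Carrier) xs → sum (concatMap h xs) ≈ ∑[ x ∈ xs ] sum (h x)
  sum-concatMap h []       = refl
  sum-concatMap h (x ∷ xs) = trans (sum-++ (h x) (concatMap h xs)) (+-congˡ (sum-concatMap h xs))

  ∑-cong : ∀ {g h : A → Carrier} xs → (∀ x → g x ≈ h x) → ∑ xs g ≈ ∑ xs h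
  ∑-cong []       g≈h = refl
  ∑-cong (x ∷ xs) g≈h = +-cong (g≈h x) (∑-cong xs g≈h)

  ∑-zero : ∀ {g : A → Carrier} xs → (∀ x → g x ≈ 0#) → ∑ xs g ≈ 0#
  ∑-zero []       g≈0 = refl
  ∑-zero (x ∷ xs) g≈0 = trans (+-cong (g≈0 x) (∑-zero xs g≈0)) (+-identityˡ 0#)

  ∑-distrib-+ : ∀ (g h : A → Carrier) xs → ∑[ x ∈ xs ] (g x + h x) ≈ ∑ xs g + ∑ xs h
  ∑-distrib-+ g h []       = sym (+-identityˡ 0#)
  ∑-distrib-+ g h (x ∷ xs) =
    trans (+-congˡ (∑-distrib-+ g h xs)) (interchange (g x) (h x) (∑ xs g) (∑ xs h))

  ∑-comm : ∀ (k : A → B → Carrier) xs ys →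
           ∑[ x ∈ xs ] ∑[ y ∈ ys ] k x y ≈ ∑[ y ∈ ys ] ∑[ x ∈ xs ] k x y
  ∑-comm k xs []       = ∑-zero xs (λ _ → refl)
  ∑-comm k xs (y ∷ ys) =
    trans (∑-distrib-+ (λ x → k x y) (λ x → ∑ ys (k x)) xs) (+-congˡ (∑-comm k xs ys))

  *-distribˡ-∑ : ∀ x (g : A → Carrier) ys → x * ∑ ys g ≈ ∑[ y ∈ ys ] (x * g y)
  *-distribˡ-∑ x g []       = zeroʳ x
  *-distribˡ-∑ x g (y ∷ ys) = trans (distribˡ x (g y) (∑ ys g)) (+-congˡ (*-distribˡ-∑ x g ys))

  ∑-allFin-suc : ∀ {n} (g : Fin (suc n) → Carrier) →
                 ∑[ v ∈ allFin (suc n) ] g v ≡ g zero + (∑[ v ∈ allFin n ] g (suc v))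
  ∑-allFin-suc g = ≡.cong (λ xs → g zero + sum xs)
    (≡.trans (map-tabulate suc g) (≡.sym (map-tabulate id (g ∘ suc))))

  ∑-select : ∀ {n} (g : Fin n → Carrier) w → (∀ v → w ≢ v → g v ≈ 0#) →
             ∑[ v ∈ allFin n ] g v ≈ g w
  ∑-select {suc n} g zero g≈0 = begin
    ∑[ v ∈ allFin (suc n) ] g v              ≡⟨ ∑-allFin-suc g ⟩
    g zero + (∑[ v ∈ allFin n ] g (suc v))   ≈⟨ +-congˡ (∑-zero (allFin n) λ v → g≈0 (suc v) λ ()) ⟩
    g zero + 0#                              ≈⟨ +-identityʳ (g zero) ⟩
    g zero                                   ∎
  ∑-select {suc n} g (suc w) g≈0 = begin
    ∑[ v ∈ allFin (suc n) ] g v              ≡⟨ ∑-allFin-suc g ⟩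
    g zero + (∑[ v ∈ allFin n ] g (suc v))   ≈⟨ +-cong (g≈0 zero λ ()) (∑-select (g ∘ suc) w g∘suc≈0) ⟩
    0# + g (suc w)                           ≈⟨ +-identityˡ (g (suc w)) ⟩
    g (suc w)                                ∎
    where
    g∘suc≈0 : ∀ v → w ≢ v → g (suc v) ≈ 0#
    g∘suc≈0 v w≢v = g≈0 (suc v) (w≢v ∘ suc-injective)

open import Data.Integer using (ℤ; +_; -_; _+_; _*_; ∣_∣; -[1+_])
import Data.Integer as ℤ
open import Data.Integer.Properties
  using (+-*-semiring; *-commutativeSemigroup; *-assoc; *-zeroʳ; *-identityˡ; -1*i≡-i;
         +-inverseˡ; +-inverseʳ; +-identityʳ; neg-distribʳ-*)
open import Relation.Binary.PropositionalEquality
  using (refl; sym; trans; cong; cong₂; module ≡-Reasoning)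

open ListSum +-*-semiring

infixl 7 _·_

_·_ : Sign → Sign → Sign
pos · s   = s
neg · pos = neg
neg · neg = pos

⟦·⟧ : ∀ a b → ⟦ a · b ⟧ ≡ ⟦ a ⟧ * ⟦ b ⟧
⟦·⟧ pos pos = refl
⟦·⟧ pos neg = refl
⟦·⟧ neg pos = refl
⟦·⟧ neg neg = refl

·-selfInverse : ∀ s → s · s ≡ pos
·-selfInverse pos = refl
·-selfInverse neg = refl

·-switch-involutive : ∀ a b s → a · (a · s · b) · b ≡ s
·-switch-involutive pos pos pos = refl
·-switch-involutive pos pos neg = refl
·-switch-involutive pos neg pos = refl
·-switch-involutive pos neg neg = refl
·-switch-involutive neg pos pos = refl
·-switch-involutive neg pos neg = refl
·-switch-involutive neg neg pos = refl
·-switch-involutive neg neg neg = refl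

compatible-resp : ∀ {x s s′} → x ≡ - ⟦ s ⟧ → s ≡ s′ → x ≡ - ⟦ s′ ⟧
compatible-resp compatible refl = compatible

flow-resp-≗ : ∀ {σ σ′ k} → σ ≗ σ′ → NowhereZeroFlow σ k → NowhereZeroFlow σ′ k
flow-resp-≗ σ≗σ′ (τ , f , τ-ok , nowhereZero , conserved) =
  τ , f , (λ e → compatible-resp (τ-ok e) (σ≗σ′ e)) , nowhereZero , conserved

boundary-∑ : ∀ τ f v → boundary τ f v ≡ ∑[ e ∈ allFin 12 ] ∑[ s ∈ allFin 2 ] contrib τ f v e s
boundary-∑ τ f v = sum-concatMap (λ e → map (contrib τ f v e) (allFin 2)) (allFin 12)

contrib-at-endpoint : ∀ τ f e s → contrib τ f (endpoint e s) e s ≡ ⟦ τ e s ⟧ * f e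
contrib-at-endpoint τ f e s with endpoint e s ≟ endpoint e s
... | yes _ = refl
... | no ≢ = contradiction refl ≢

contrib-elsewhere : ∀ τ f v e s → endpoint e s ≢ v → contrib τ f v e s ≡ + 0
contrib-elsewhere τ f v e s ≢v with endpoint e s ≟ v
... | yes ≡v = contradiction ≡v ≢v
... | no _   = refl

∑-boundary : ∀ τ f →
  ∑[ v ∈ allFin 8 ] boundary τ f v ≡ ∑[ e ∈ allFin 12 ] ∑[ s ∈ allFin 2 ] ⟦ τ e s ⟧ * f e
∑-boundary τ f = begin
  ∑[ v ∈ allFin 8 ] boundary τ f v
    ≡⟨ ∑-cong (allFin 8) (boundary-∑ τ f) ⟩
  ∑[ v ∈ allFin 8 ] ∑[ e ∈ allFin 12 ] ∑[ s ∈ allFin 2 ] contrib τ f v e s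
    ≡⟨ ∑-comm (λ v e → ∑[ s ∈ allFin 2 ] contrib τ f v e s) (allFin 8) (allFin 12) ⟩
  ∑[ e ∈ allFin 12 ] ∑[ v ∈ allFin 8 ] ∑[ s ∈ allFin 2 ] contrib τ f v e s
    ≡⟨ ∑-cong (allFin 12) (λ e → ∑-comm (λ v s → contrib τ f v e s) (allFin 8) (allFin 2)) ⟩
  ∑[ e ∈ allFin 12 ] ∑[ s ∈ allFin 2 ] ∑[ v ∈ allFin 8 ] contrib τ f v e s
    ≡⟨ ∑-cong (allFin 12) (λ e → ∑-cong (allFin 2) (λ s → ∑-at-endpoint e s)) ⟩
  ∑[ e ∈ allFin 12 ] ∑[ s ∈ allFin 2 ] ⟦ τ e s ⟧ * f e
    ∎
  where
  open ≡-Reasoning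
  ∑-at-endpoint : ∀ e s → ∑[ v ∈ allFin 8 ] contrib τ f v e s ≡ ⟦ τ e s ⟧ * f e
  ∑-at-endpoint e s = trans
    (∑-select (λ v → contrib τ f v e s) (endpoint e s) (λ v → contrib-elsewhere τ f v e s))
    (contrib-at-endpoint τ f e s)

∑-allFin-2 : ∀ (g : Fin 2 → ℤ) → ∑[ s ∈ allFin 2 ] g s ≡ g 0F + g 1F
∑-allFin-2 g = cong (λ y → g 0F + y) (+-identityʳ (g 1F))

positive-edge-cancels : ∀ t₀ t₁ → ⟦ t₀ ⟧ * ⟦ t₁ ⟧ ≡ - ⟦ pos ⟧ → ∀ x → ⟦ t₀ ⟧ * x + ⟦ t₁ ⟧ * x ≡ + 0
positive-edge-cancels pos pos () x
positive-edge-cancels pos neg _ x = trans (cong₂ _+_ (*-identityˡ x) (-1*i≡-i x)) (+-inverseʳ x)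
positive-edge-cancels neg pos _ x = trans (cong₂ _+_ (-1*i≡-i x) (*-identityˡ x)) (+-inverseˡ x)
positive-edge-cancels neg neg () x

negative-edge-nonzero : ∀ t₀ t₁ → ⟦ t₀ ⟧ * ⟦ t₁ ⟧ ≡ - ⟦ neg ⟧ →
                           ∀ x → 1 ℕ.≤ ∣ x ∣ → ⟦ t₀ ⟧ * x + ⟦ t₁ ⟧ * x ≢ + 0
negative-edge-nonzero pos pos _ (+ suc n)  _ ()
negative-edge-nonzero pos pos _ -[1+ n ]   _ ()
negative-edge-nonzero neg neg _ (+ suc n)  _ ()
negative-edge-nonzero neg neg _ -[1+ n ]   _ ()
negative-edge-nonzero pos neg ()
negative-edge-nonzero neg pos ()

oneNegativeEdge-noFlow : ∀ {σ k} e₀ → σ e₀ ≡ neg → (∀ e → e₀ ≢ e → σ e ≡ pos) → ¬ NowhereZeroFlow σ k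
oneNegativeEdge-noFlow e₀ σe₀≡neg σe≡pos (τ , f , τ-ok , nowhereZero , conserved) =
  negative-edge-nonzero (τ e₀ 0F) (τ e₀ 1F) (compatible-resp (τ-ok e₀) σe₀≡neg)
    (f e₀) (proj₁ (nowhereZero e₀)) (begin
      ⟦ τ e₀ 0F ⟧ * f e₀ + ⟦ τ e₀ 1F ⟧ * f e₀   ≡⟨ sym (∑-allFin-2 (λ s → ⟦ τ e₀ s ⟧ * f e₀)) ⟩
      edgeOutflow e₀                             ≡⟨ sym (∑-select edgeOutflow e₀ cancels) ⟩
      ∑[ e ∈ allFin 12 ] edgeOutflow e           ≡⟨ sym (∑-boundary τ f) ⟩
      ∑[ v ∈ allFin 8 ] boundary τ f v           ≡⟨ ∑-zero (allFin 8) conserved ⟩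
      + 0                                        ∎)
  where
  open ≡-Reasoning
  edgeOutflow : Edge → ℤ
  edgeOutflow e = ∑[ s ∈ allFin 2 ] ⟦ τ e s ⟧ * f e
  cancels : ∀ e → e₀ ≢ e → edgeOutflow e ≡ + 0
  cancels e e₀≢e = trans (∑-allFin-2 (λ s → ⟦ τ e s ⟧ * f e))
    (positive-edge-cancels (τ e 0F) (τ e 1F) (compatible-resp (τ-ok e) (σe≡pos e e₀≢e)) (f e))

oneNegative : Edge → Signature
oneNegative e₀ e = if does (e₀ ≟ e) then neg else pos

oneNegative-noFlow : ∀ {k} e₀ → ¬ NowhereZeroFlow (oneNegative e₀) k
oneNegative-noFlow e₀ = oneNegativeEdge-noFlow e₀
  (cong (if_then neg else pos) (dec-true (e₀ ≟ e₀) refl))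
  (λ e e₀≢e → cong (if_then neg else pos) (dec-false (e₀ ≟ e) e₀≢e))

switch : (Vertex → Sign) → Signature → Signature
switch ε σ e = ε (endpoint e 0F) · σ e · ε (endpoint e 1F)

switchOrientation : (Vertex → Sign) → Orientation → Orientation
switchOrientation ε τ e s = ε (endpoint e s) · τ e s

switch-compatible : ∀ a b s t₀ t₁ → ⟦ t₀ ⟧ * ⟦ t₁ ⟧ ≡ - ⟦ s ⟧ → ⟦ a · t₀ ⟧ * ⟦ b · t₁ ⟧ ≡ - ⟦ a · s · b ⟧
switch-compatible a b s t₀ t₁ compatible = begin
  ⟦ a · t₀ ⟧ * ⟦ b · t₁ ⟧                ≡⟨ cong₂ _*_ (⟦·⟧ a t₀) (⟦·⟧ b t₁) ⟩
  (⟦ a ⟧ * ⟦ t₀ ⟧) * (⟦ b ⟧ * ⟦ t₁ ⟧)      ≡⟨ interchange ⟦ a ⟧ ⟦ t₀ ⟧ ⟦ b ⟧ ⟦ t₁ ⟧ ⟩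
  (⟦ a ⟧ * ⟦ b ⟧) * (⟦ t₀ ⟧ * ⟦ t₁ ⟧)      ≡⟨ cong (⟦ a ⟧ * ⟦ b ⟧ *_) compatible ⟩
  (⟦ a ⟧ * ⟦ b ⟧) * - ⟦ s ⟧                ≡⟨ sym (neg-distribʳ-* (⟦ a ⟧ * ⟦ b ⟧) ⟦ s ⟧) ⟩
  - ((⟦ a ⟧ * ⟦ b ⟧) * ⟦ s ⟧)              ≡⟨ cong -_ (xy∙z≈xz∙y ⟦ a ⟧ ⟦ b ⟧ ⟦ s ⟧) ⟩
  - ((⟦ a ⟧ * ⟦ s ⟧) * ⟦ b ⟧)              ≡⟨ cong (λ x → - (x * ⟦ b ⟧)) (sym (⟦·⟧ a s)) ⟩
  - (⟦ a · s ⟧ * ⟦ b ⟧)                    ≡⟨ cong -_ (sym (⟦·⟧ (a · s) b)) ⟩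
  - ⟦ a · s · b ⟧                          ∎
  where
  open ≡-Reasoning
  open import Algebra.Properties.CommutativeSemigroup *-commutativeSemigroup using (interchange; xy∙z≈xz∙y)

contrib-switch : ∀ ε τ f v e s → contrib (switchOrientation ε τ) f v e s ≡ ⟦ ε v ⟧ * contrib τ f v e s
contrib-switch ε τ f v e s with endpoint e s ≟ v
... | yes refl = trans (cong (_* f e) (⟦·⟧ (ε v) (τ e s))) (*-assoc ⟦ ε v ⟧ ⟦ τ e s ⟧ (f e))
... | no _     = sym (*-zeroʳ ⟦ ε v ⟧)

boundary-switch : ∀ ε τ f v → boundary (switchOrientation ε τ) f v ≡ ⟦ ε v ⟧ * boundary τ f v
boundary-switch ε τ f v = begin
  boundary (switchOrientation ε τ) f v
    ≡⟨ boundary-∑ (switchOrientation ε τ) f v ⟩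
  ∑[ e ∈ allFin 12 ] ∑[ s ∈ allFin 2 ] contrib (switchOrientation ε τ) f v e s
    ≡⟨ ∑-cong (allFin 12) (λ e → ∑-cong (allFin 2) (contrib-switch ε τ f v e)) ⟩
  ∑[ e ∈ allFin 12 ] ∑[ s ∈ allFin 2 ] ⟦ ε v ⟧ * contrib τ f v e s
    ≡⟨ ∑-cong (allFin 12) (λ e → sym (*-distribˡ-∑ ⟦ ε v ⟧ (contrib τ f v e) (allFin 2))) ⟩
  ∑[ e ∈ allFin 12 ] ⟦ ε v ⟧ * (∑[ s ∈ allFin 2 ] contrib τ f v e s)
    ≡⟨ sym (*-distribˡ-∑ ⟦ ε v ⟧ (λ e → ∑[ s ∈ allFin 2 ] contrib τ f v e s) (allFin 12)) ⟩
  ⟦ ε v ⟧ * (∑[ e ∈ allFin 12 ] ∑[ s ∈ allFin 2 ] contrib τ f v e s)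
    ≡⟨ cong (⟦ ε v ⟧ *_) (sym (boundary-∑ τ f v)) ⟩
  ⟦ ε v ⟧ * boundary τ f v
    ∎
  where open ≡-Reasoning

switch-flow : ∀ ε {σ k} → NowhereZeroFlow σ k → NowhereZeroFlow (switch ε σ) k
switch-flow ε {σ} (τ , f , τ-ok , nowhereZero , conserved) =
  switchOrientation ε τ , f , compatible , nowhereZero , conserved′
  where
  compatible : IsOrientation (switch ε σ) (switchOrientation ε τ)
  compatible e = switch-compatible (ε (endpoint e 0F)) (ε (endpoint e 1F)) (σ e) (τ e 0F) (τ e 1F) (τ-ok e)
  conserved′ : ∀ v → boundary (switchOrientation ε τ) f v ≡ + 0
  conserved′ v = trans (boundary-switch ε τ f v) (trans (cong (⟦ ε v ⟧ *_) (conserved v)) (*-zeroʳ ⟦ ε v ⟧))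

unswitch-flow : ∀ ε {σ k} → NowhereZeroFlow (switch ε σ) k → NowhereZeroFlow σ k
unswitch-flow ε {σ} φ =
  flow-resp-≗ (λ e → ·-switch-involutive (ε (endpoint e 0F)) (ε (endpoint e 1F)) (σ e)) (switch-flow ε φ)

treePotential : Signature → Vertex → Sign
treePotential σ 0F = pos
treePotential σ 1F = σ 0F
treePotential σ 2F = σ 0F · σ 1F
treePotential σ 3F = σ 0F · σ 1F · σ 2F
treePotential σ 4F = σ 8F
treePotential σ 5F = σ 0F · σ 9F
treePotential σ 6F = σ 0F · σ 1F · σ 10F
treePotential σ 7F = σ 0F · σ 1F · σ 2F · σ 11F

canonical : Signature → Signature
canonical σ = switch (treePotential σ) σ

fromCotree : Sign → Sign → Sign → Sign → Sign → Signature
fromCotree c₃ _  _  _  _  3F = c₃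
fromCotree _  c₄ _  _  _  4F = c₄
fromCotree _  _  c₅ _  _  5F = c₅
fromCotree _  _  _  c₆ _  6F = c₆
fromCotree _  _  _  _  c₇ 7F = c₇
fromCotree _  _  _  _  _  _  = pos

canonical-fromCotree : ∀ σ → canonical σ ≗
  fromCotree (canonical σ 3F) (canonical σ 4F) (canonical σ 5F) (canonical σ 6F) (canonical σ 7F)
canonical-fromCotree σ 0F  = ·-selfInverse (σ 0F)
canonical-fromCotree σ 1F  = ·-selfInverse (σ 0F · σ 1F)
canonical-fromCotree σ 2F  = ·-selfInverse (σ 0F · σ 1F · σ 2F)
canonical-fromCotree σ 3F  = refl
canonical-fromCotree σ 4F  = refl
canonical-fromCotree σ 5F  = refl
canonical-fromCotree σ 6F  = refl
canonical-fromCotree σ 7F  = refl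
canonical-fromCotree σ 8F  = ·-selfInverse (σ 8F)
canonical-fromCotree σ 9F  = ·-selfInverse (σ 0F · σ 9F)
canonical-fromCotree σ 10F = ·-selfInverse (σ 0F · σ 1F · σ 10F)
canonical-fromCotree σ 11F = ·-selfInverse (σ 0F · σ 1F · σ 2F · σ 11F)

referenceOrientation : Signature → Orientation
referenceOrientation σ e 0F = pos
referenceOrientation σ e 1F = neg · σ e

referenceOrientation-compatible : ∀ σ → IsOrientation σ (referenceOrientation σ)
referenceOrientation-compatible σ e = compatible (σ e)
  where
  compatible : ∀ s → ⟦ pos ⟧ * ⟦ neg · s ⟧ ≡ - ⟦ s ⟧
  compatible pos = refl
  compatible neg = refl

nowhereZero? : ∀ k (f : Edge → ℤ) → Dec (∀ e → 1 ℕ.≤ ∣ f e ∣ × ∣ f e ∣ ℕ.< k)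
nowhereZero? k f = all? (λ e → (1 ℕ.≤? ∣ f e ∣) ×-dec (∣ f e ∣ ℕ.<? k))

conserved? : ∀ τ f → Dec (∀ v → boundary τ f v ≡ + 0)
conserved? τ f = all? (λ v → boundary τ f v ℤ.≟ + 0)

_≟ˢ_ : DecidableEquality Sign
pos ≟ˢ pos = yes refl
pos ≟ˢ neg = no λ ()
neg ≟ˢ pos = no λ ()
neg ≟ˢ neg = yes refl

_≗?_ : (σ σ′ : Signature) → Dec (σ ≗ σ′)
σ ≗? σ′ = all? (λ e → σ e ≟ˢ σ′ e)

-- The values of a flow certificate are read against referenceOrientation: a negative value
-- stands for the positive value on the edge with both half-edges reversed.
data Certificate (σ : Signature) : Set where
  flow : (values : Vec ℤ 12) →
    {True (nowhereZero? 6 (lookup values) ×-dec conserved? (referenceOrientation σ) (lookup values))} →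
    Certificate σ
  switchingToOneNegative : (e₀ : Edge) → {True (σ ≗? canonical (oneNegative e₀))} → Certificate σ

SwitchingOfOneNegative : Signature → Set
SwitchingOfOneNegative σ = ∃[ e₀ ] σ ≗ canonical (oneNegative e₀)

certified : ∀ {σ} → Certificate σ → NowhereZeroFlow σ 6 ⊎ SwitchingOfOneNegative σ
certified {σ} (flow values {valid}) =
  inj₁ (referenceOrientation σ , lookup values , referenceOrientation-compatible σ , toWitness valid)
certified (switchingToOneNegative e₀ {equal}) = inj₂ (e₀ , toWitness equal)

certificate : ∀ c₃ c₄ c₅ c₆ c₇ → Certificate (fromCotree c₃ c₄ c₅ c₆ c₇)
certificate pos pos pos pos pos = flow (  + 4 ∷   + 5 ∷   + 4 ∷   + 5 ∷   + 5 ∷   + 4 ∷   + 5 ∷   + 4 ∷   + 1 ∷ - + 1 ∷   + 1 ∷ - + 1 ∷ [])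
certificate pos pos pos pos neg = switchingToOneNegative 7F
certificate pos pos pos neg pos = switchingToOneNegative 6F
certificate pos pos pos neg neg = switchingToOneNegative 11F
certificate pos pos neg pos pos = switchingToOneNegative 5F
certificate pos pos neg pos neg = flow (  + 4 ∷   + 5 ∷   + 2 ∷   + 5 ∷   + 5 ∷   + 4 ∷ - + 1 ∷ - + 4 ∷   + 1 ∷ - + 1 ∷   + 3 ∷ - + 3 ∷ [])
certificate pos pos neg neg pos = switchingToOneNegative 10F
certificate pos pos neg neg neg = flow (  + 3 ∷   + 4 ∷   + 1 ∷   + 5 ∷   + 5 ∷   + 4 ∷ - + 1 ∷ - + 3 ∷   + 2 ∷ - + 1 ∷   + 3 ∷ - + 4 ∷ [])
certificate pos neg pos pos pos = switchingToOneNegative 4F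
certificate pos neg pos pos neg = switchingToOneNegative 8F
certificate pos neg pos neg pos = flow (  + 3 ∷ - + 1 ∷   + 3 ∷   + 5 ∷   + 5 ∷ - + 1 ∷ - + 5 ∷   + 3 ∷   + 2 ∷   + 4 ∷ - + 4 ∷ - + 2 ∷ [])
certificate pos neg pos neg neg = flow (  + 4 ∷ - + 1 ∷   + 1 ∷   + 5 ∷   + 4 ∷   + 1 ∷ - + 1 ∷ - + 3 ∷   + 1 ∷   + 5 ∷ - + 2 ∷ - + 4 ∷ [])
certificate pos neg neg pos pos = switchingToOneNegative 9F
certificate pos neg neg pos neg = flow (  + 4 ∷   + 1 ∷   + 3 ∷   + 5 ∷   + 4 ∷ - + 1 ∷ - + 1 ∷ - + 3 ∷   + 1 ∷   + 3 ∷ - + 2 ∷ - + 2 ∷ [])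
certificate pos neg neg neg pos = flow (  + 3 ∷ - + 1 ∷   + 4 ∷   + 5 ∷   + 5 ∷ - + 1 ∷ - + 4 ∷   + 3 ∷   + 2 ∷   + 4 ∷ - + 5 ∷ - + 1 ∷ [])
certificate pos neg neg neg neg = flow (  + 3 ∷ - + 1 ∷   + 1 ∷   + 5 ∷   + 5 ∷ - + 1 ∷ - + 1 ∷ - + 3 ∷   + 2 ∷   + 4 ∷ - + 2 ∷ - + 4 ∷ [])
certificate neg pos pos pos pos = switchingToOneNegative 3F
certificate neg pos pos pos neg = flow (  + 4 ∷   + 3 ∷ - + 1 ∷ - + 5 ∷ - + 4 ∷ - + 3 ∷   + 1 ∷   + 5 ∷   + 1 ∷   + 1 ∷   + 4 ∷   + 4 ∷ [])
certificate neg pos pos neg pos = flow (  + 4 ∷ - + 1 ∷ - + 4 ∷ - + 5 ∷ - + 3 ∷   + 2 ∷   + 5 ∷ - + 4 ∷   + 1 ∷   + 5 ∷   + 3 ∷   + 1 ∷ [])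
certificate neg pos pos neg neg = switchingToOneNegative 2F
certificate neg pos neg pos pos = flow (  + 1 ∷ - + 3 ∷ - + 4 ∷ - + 5 ∷   + 1 ∷   + 5 ∷ - + 4 ∷ - + 3 ∷   + 4 ∷   + 4 ∷   + 1 ∷   + 1 ∷ [])
certificate neg pos neg pos neg = switchingToOneNegative 1F
certificate neg pos neg neg pos = flow (  + 4 ∷   + 1 ∷ - + 4 ∷ - + 5 ∷ - + 2 ∷   + 1 ∷   + 4 ∷ - + 3 ∷   + 1 ∷   + 3 ∷   + 5 ∷   + 1 ∷ [])
certificate neg pos neg neg neg = flow (  + 4 ∷ - + 1 ∷ - + 2 ∷ - + 5 ∷ - + 3 ∷   + 2 ∷ - + 1 ∷   + 4 ∷   + 1 ∷   + 5 ∷   + 1 ∷   + 3 ∷ [])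
certificate neg neg pos pos pos = flow (  + 2 ∷   + 1 ∷ - + 1 ∷ - + 5 ∷   + 5 ∷ - + 4 ∷ - + 2 ∷   + 2 ∷   + 3 ∷   + 1 ∷   + 2 ∷   + 4 ∷ [])
certificate neg neg pos pos neg = switchingToOneNegative 0F
certificate neg neg pos neg pos = flow (  + 1 ∷ - + 1 ∷ - + 4 ∷ - + 5 ∷   + 1 ∷   + 1 ∷   + 4 ∷ - + 3 ∷   + 4 ∷   + 2 ∷   + 3 ∷   + 1 ∷ [])
certificate neg neg pos neg neg = flow (  + 1 ∷   + 4 ∷ - + 1 ∷ - + 5 ∷   + 1 ∷ - + 4 ∷   + 1 ∷   + 3 ∷   + 4 ∷ - + 3 ∷   + 5 ∷   + 4 ∷ [])
certificate neg neg neg pos pos = flow (  + 1 ∷ - + 4 ∷ - + 3 ∷ - + 5 ∷   + 1 ∷   + 4 ∷ - + 5 ∷ - + 3 ∷   + 4 ∷   + 5 ∷ - + 1 ∷   + 2 ∷ [])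
certificate neg neg neg pos neg = flow (  + 4 ∷   + 3 ∷ - + 2 ∷ - + 5 ∷ - + 3 ∷   + 4 ∷   + 1 ∷   + 4 ∷   + 1 ∷   + 1 ∷   + 5 ∷   + 3 ∷ [])
certificate neg neg neg neg pos = flow (  + 3 ∷   + 1 ∷ - + 3 ∷ - + 5 ∷   + 1 ∷   + 1 ∷   + 3 ∷ - + 1 ∷   + 2 ∷   + 2 ∷   + 4 ∷   + 2 ∷ [])
certificate neg neg neg neg neg = flow (  + 4 ∷   + 3 ∷ - + 1 ∷ - + 5 ∷ - + 4 ∷   + 5 ∷ - + 1 ∷   + 5 ∷   + 1 ∷   + 1 ∷   + 4 ∷   + 4 ∷ [])

mainTheorem5 : (σ : Signature) → FlowAdmissible σ → NowhereZeroFlow σ 6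
mainTheorem5 σ (k , φ)
  with certified (certificate (canonical σ 3F) (canonical σ 4F) (canonical σ 5F) (canonical σ 6F) (canonical σ 7F))
... | inj₁ φ₆ = unswitch-flow (treePotential σ) (flow-resp-≗ (sym ∘ canonical-fromCotree σ) φ₆)
... | inj₂ (e₀ , ≗one) =
  ⊥-elim (oneNegative-noFlow e₀ (unswitch-flow (treePotential (oneNegative e₀))
    (flow-resp-≗ (λ e → trans (canonical-fromCotree σ e) (≗one e)) (switch-flow (treePotential σ) φ))))
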